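{- For all positive integers $d$ and $m$, \begin{align*} H_{d^m} &= \sum_{k=0}^{\lfloor d/2 \rfloor} H_{k^{2m}} E^+_{(d - 2k)^m}, & H^+_{d^m} &= \sum_{k=0}^{\lfloor d/2 \rfloor} H_{k^{2m}} E_{(d - 2k)^m}, \\ E_{d^m} &= \sum_{k=0}^{\lfloor d/2 \rfloor} E_{k^{2m}} H^+_{(d - 2k)^m}, & E^+_{d^m} &= \sum_{k=0}^{\lfloor d/2 \rfloor} E_{k^{2m}} H_{(d - 2k)^m}. \end{align*}
   Context: $\mathsf{P\Lambda}$ denotes the $\mathbb{Q}$-algebra of polysymmetric functions: formal power series of bounded degree in variables $x_{i,j}$ ($i,j\ge1$), $x_{i,j}$ of degree $i$, invariant under every permutation of $x_{i,1},x_{i,2},\dots$ for each fixed $i$. A stack is a pair of positive integers $d^m$ (degree $d$, multiplicity $m$); a stack partition $\tau\Vdash n$ is a finite weakly decreasing sequence of stacks $(d_1^{m_1},\dots,d_s^{m_s})$ with $\sum d_im_i=n$; an ordinary partition $\alpha\vdash n$ has all multiplicities $1$; $\ell(\alpha)$ is the number of stacks and $\operatorname{area}(\tau)=\sum m_i$. $M_\tau=\sum_\alpha x_{d_1,\alpha_1}^{m_1}\cdots x_{d_s,\alpha_s}^{m_s}$ over sequences $\alpha$ of positive integers with $\alpha_i\ne\alpha_j$ whenever $d_i=d_j$, $i\ne j$. Define $H_d=\sum_{\alpha\Vdash d}M_\alpha$, $E^+_d=\sum_{\alpha\vdash d}M_\alpha$, $E_d=\sum_{\alpha\vdash d}(-1)^{\ell(\alpha)}M_\alpha$,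 $H^+_d=\sum_{\alpha\Vdash d}(-1)^{\operatorname{area}(\alpha)}M_\alpha$, with value $1$ for $d=0$; equivalently their generating functions $\sum_d F_dt^d$ are $\prod_{i,j}(1-x_{i,j}t^i)^{ -1}$, $\prod_{i,j}(1+x_{i,j}t^i)$, $\prod_{i,j}(1-x_{i,j}t^i)$, $\prod_{i,j}(1+x_{i,j}t^i)^{ -1}$ respectively. For each such $F$, $F_{d^m}$ denotes $F_d$ with each $x_{i,j}$ replaced by $x_{i,j}^m$ (so $F_{0^m}=1$). -}

module Defs where

open import Data.Nat using (ℕ; zero; suc; _+_; _*_; _∸_; _≡ᵇ_; _≤ᵇ_; ⌊_/2⌋)
open import Data.Bool using (Bool; true; false; if_then_else_; _∧_)
open import Data.List using (List; []; _∷_; map; concatMap; upTo; zipWith)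
open import Data.Nat.ListAction using (sum)
open import Data.Maybe using (Maybe; just; nothing)
open import Data.Rational using (ℚ; 0ℚ; 1ℚ; -_) renaming (_+_ to _+ℚ_; _*_ to _*ℚ_)
open import Relation.Binary.PropositionalEquality using (_≡_)

-- Monomials in the variables x_{i,j} (i, j ≥ 1), x_{i,j} of degree i.
-- A monomial is a list of rows; the (i-1)-th row lists the exponents of
-- x_{i,1}, x_{i,2}, ... .  Missing entries mean exponent 0, so a monomial
-- has several (zero-padded) representations; every function below only
-- depends on the monomial itself.

Mono : Set
Mono = List (List ℕ)

Series : Set
Series = Mono → ℚ

degFrom : ℕ → Mono → ℕ
degFrom i []       = 0
degFrom i (r ∷ rs) = i * sum r + degFrom (suc i) rs

deg : Mono → ℕ
deg = degFrom 1

totalExp : Mono → ℕ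
totalExp e = sum (map sum e)

nonzero : ℕ → Bool
nonzero zero    = false
nonzero (suc _) = true

countNZ : List ℕ → ℕ
countNZ []       = 0
countNZ (n ∷ ns) = (if nonzero n then 1 else 0) + countNZ ns

numVars : Mono → ℕ
numVars e = sum (map countNZ e)

rowSqfree : List ℕ → Bool
rowSqfree []       = true
rowSqfree (n ∷ ns) = (n ≤ᵇ 1) ∧ rowSqfree ns

squarefree : Mono → Bool
squarefree []       = true
squarefree (r ∷ rs) = rowSqfree r ∧ squarefree rs

sgn : ℕ → ℚ
sgn zero    = 1ℚ
sgn (suc n) = - sgn n

rowDivs : List ℕ → List (List ℕ)
rowDivs []       = [] ∷ []
rowDivs (e ∷ es) = concatMap (λ a → map (a ∷_) (rowDivs es)) (upTo (suc e))

monoDivs : Mono → List Mono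
monoDivs []       = [] ∷ []
monoDivs (r ∷ rs) = concatMap (λ u → map (u ∷_) (monoDivs rs)) (rowDivs r)

monoSub : Mono → Mono → Mono
monoSub = zipWith (zipWith _∸_)

_⊛_ : Series → Series → Series
(f ⊛ g) e = foldrℚ (map (λ u → f u *ℚ g (monoSub e u)) (monoDivs e))
  where
  foldrℚ : List ℚ → ℚ
  foldrℚ []       = 0ℚ
  foldrℚ (x ∷ xs) = x +ℚ foldrℚ xs

_⊕_ : Series → Series → Series
(f ⊕ g) e = f e +ℚ g e

zeroS : Series
zeroS _ = 0ℚ

sumS : ℕ → (ℕ → Series) → Series
sumS zero    f = zeroS
sumS (suc n) f = sumS n f ⊕ f n

-- Unfolding the definitions via the monomial
-- symmetric functions M_α: every monomial of degree d occurs in exactly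
-- one M_α (α ⊩ d), squarefree ones correspond to ordinary partitions
-- α ⊢ d, ℓ(α) = number of variables, area(α) = total exponent.

[_≡deg_] : Mono → ℕ → Bool
[ e ≡deg d ] = deg e ≡ᵇ d

-- H_d = Σ_{α ⊩ d} M_α
H : ℕ → Series
H d e = if [ e ≡deg d ] then 1ℚ else 0ℚ

-- E⁺_d = Σ_{α ⊢ d} M_α
E⁺ : ℕ → Series
E⁺ d e = if [ e ≡deg d ] ∧ squarefree e then 1ℚ else 0ℚ

-- E_d = Σ_{α ⊢ d} (-1)^{ℓ(α)} M_α
E : ℕ → Series
E d e = if [ e ≡deg d ] ∧ squarefree e then sgn (numVars e) else 0ℚ

-- H⁺_d = Σ_{α ⊩ d} (-1)^{area(α)} M_α
H⁺ : ℕ → Series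
H⁺ d e = if [ e ≡deg d ] then sgn (totalExp e) else 0ℚ

-- Plethystic substitution x_{i,j} ↦ x_{i,j}^m.

exactDiv : ℕ → ℕ → Maybe ℕ
exactDiv m n = go (upTo (suc n))
  where
  go : List ℕ → Maybe ℕ
  go []       = nothing
  go (q ∷ qs) = if q * m ≡ᵇ n then just q else go qs

rowDiv : ℕ → List ℕ → Maybe (List ℕ)
rowDiv m []       = just []
rowDiv m (n ∷ ns) with exactDiv m n | rowDiv m ns
... | just q | just qs = just (q ∷ qs)
... | _      | _       = nothing

monoDiv : ℕ → Mono → Maybe Mono
monoDiv m []       = just []
monoDiv m (r ∷ rs) with rowDiv m r | monoDiv m rs
... | just u | just us = just (u ∷ us)
... | _      | _       = nothing

pleth : ℕ → Series → Series
pleth m F e with monoDiv m e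
... | just u  = F u
... | nothing = 0ℚ

_≈S_ : Series → Series → Set
f ≈S g = ∀ e → f e ≡ g e

conv : (ℕ → Series) → (ℕ → Series) → ℕ → ℕ → Series
conv A B d m = sumS (suc ⌊ d /2⌋) (λ k → pleth (2 * m) (A k) ⊛ pleth m (B (d ∸ 2 * k)))

{-# OPTIONS --safe #-}
-- Each family is the degree-d part of a product ∏_{i,j} w(x_{i,j}) over all
-- variables, with w(t) = 1/(1-t), 1+t, 1-t, 1/(1+t) for H, E⁺, E, H⁺: its
-- coefficient at a monomial is the product of the coefficients of w at the
-- exponents.  Such products multiply factorwise, and plethysm by m replaces
-- w(t) by w(tᵐ), so the identities come from
--   1/(1-t) = (1+t)/(1-t²),   1/(1+t) = (1-t)/(1-t²),
--   1-t = (1-t²)/(1+t),       1+t = (1-t²)/(1-t),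
-- by taking degree-md parts: the first factor lives in degrees divisible by
-- 2m and the second in degrees divisible by m, so the degree-md part of their
-- product is the sum over k of (degree 2mk) × (degree m(d-2k)).
module Submission where

open import Defs
open import Data.Nat using (ℕ; _≤_; zero; suc; _+_; _*_; _∸_; _<_; _≡ᵇ_; _≤ᵇ_; ⌊_/2⌋; ⌈_/2⌉; z≤n; s≤s; NonZero; >-nonZero; >-nonZero⁻¹)
open import Data.Nat.Properties as ℕ using (_≟_)
open import Data.Nat.ListAction using (sum)
open import Data.Product using (_×_; _,_)
open import Data.Nat.Divisibility using (_∤_; _∣?_; divides; divides-refl; ∣-trans; n∣m*n; *-cancelʳ-∣; ∣m∸n∣n⇒∣m)
open import Data.Rational using (ℚ; 0ℚ; 1ℚ; -_) renaming (_+_ to _+ℚ_; _*_ to _*ℚ_; _-_ to _-ℚ_)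
import Data.Rational.Properties as ℚ
open import Data.List using (List; []; _∷_; map; foldr; concatMap; upTo; applyUpTo; zipWith; _++_; _∷ʳ_)
import Data.List.Properties as List
open import Data.List.Relation.Unary.All using (All; []; _∷_)
import Data.List.Relation.Unary.All as All
import Data.List.Relation.Unary.All.Properties as All
open import Data.Maybe using (Maybe; just; nothing; maybe′)
open import Data.Bool using (Bool; true; false; if_then_else_; T; _∧_)
open import Data.Sum using (inj₁; inj₂)
open import Data.Empty using (⊥-elim)
open import Data.List.Relation.Unary.Any using (here; there)
open import Data.List.Membership.Propositional using (_∈_)
open import Data.List.Membership.Propositional.Properties using (∈-upTo⁺)
open import Function using (_∘_; id)
open import Relation.Binary.PropositionalEquality
open import Relation.Nullary using (¬_; Dec; yes; no; does)
open import Relation.Nullary.Decidable using (dec-true; dec-false)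
open import Algebra.Bundles using (CommutativeMonoid)
open import Algebra.Properties.CommutativeSemigroup (CommutativeMonoid.commutativeSemigroup ℚ.+-0-commutativeMonoid)
  using () renaming (interchange to +-interchange)
open import Algebra.Properties.CommutativeSemigroup (CommutativeMonoid.commutativeSemigroup ℚ.*-1-commutativeMonoid)
  using () renaming (interchange to *-interchange)
open import Algebra.Properties.Ring ℚ.+-*-ring using (-1*x≈-x; -‿involutive)
open import Algebra.Properties.CommutativeSemigroup ℕ.+-commutativeSemigroup
  using () renaming (interchange to ℕ-+-interchange)

private variable A B : Set

*-vanishˡ : ∀ {x} y → x ≡ 0ℚ → x *ℚ y ≡ 0ℚ
*-vanishˡ y refl = ℚ.*-zeroˡ y

*-vanishʳ : ∀ x {y} → y ≡ 0ℚ → x *ℚ y ≡ 0ℚ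
*-vanishʳ x refl = ℚ.*-zeroʳ x

if-vanish : ∀ b {x} → x ≡ 0ℚ → (if b then x else 0ℚ) ≡ 0ℚ
if-vanish true  x≡0 = x≡0
if-vanish false x≡0 = refl

if-yes : ∀ {P : Set} (p? : Dec P) → P → ∀ x → (if does p? then x else 0ℚ) ≡ x
if-yes p? p x = cong (λ b → if b then x else 0ℚ) (dec-true p? p)

if-no : ∀ {P : Set} (p? : Dec P) → ¬ P → ∀ x → (if does p? then x else 0ℚ) ≡ 0ℚ
if-no p? ¬p x = cong (λ b → if b then x else 0ℚ) (dec-false p? ¬p)

-- Finite sums

∑ : List A → (A → ℚ) → ℚ
∑ xs f = foldr _+ℚ_ 0ℚ (map f xs)

syntax ∑ xs (λ x → t) = ∑[ x ∈ xs ] t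

∑< : ℕ → (ℕ → ℚ) → ℚ
∑< zero    f = 0ℚ
∑< (suc n) f = ∑< n f +ℚ f n

syntax ∑< n (λ k → t) = ∑[ k < n ] t

-- rowDivs (a ∷ as) and monoDivs (r ∷ rs) are, by definition,
-- upTo (suc a) ⊗ rowDivs as and rowDivs r ⊗ monoDivs rs.
_⊗_ : List A → List (List A) → List (List A)
xs ⊗ yss = concatMap (λ x → map (x ∷_) yss) xs

∑-map : ∀ xs (g : A → B) (f : B → ℚ) → ∑ (map g xs) f ≡ ∑ xs (f ∘ g)
∑-map xs g f = cong (foldr _+ℚ_ 0ℚ) (sym (List.map-∘ xs))

∑-cong : ∀ xs {f g : A → ℚ} → (∀ x → f x ≡ g x) → ∑ xs f ≡ ∑ xs g
∑-cong []       eq = refl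
∑-cong (x ∷ xs) eq = cong₂ _+ℚ_ (eq x) (∑-cong xs eq)

∑-cong-All : ∀ {xs} {f g : A → ℚ} → All (λ x → f x ≡ g x) xs → ∑ xs f ≡ ∑ xs g
∑-cong-All []         = refl
∑-cong-All (eq ∷ eqs) = cong₂ _+ℚ_ eq (∑-cong-All eqs)

∑-zero : ∀ (xs : List A) → ∑[ x ∈ xs ] 0ℚ ≡ 0ℚ
∑-zero []       = refl
∑-zero (x ∷ xs) = trans (ℚ.+-identityˡ _) (∑-zero xs)

∑-+ : ∀ xs (f g : A → ℚ) → ∑[ x ∈ xs ] (f x +ℚ g x) ≡ ∑ xs f +ℚ ∑ xs g
∑-+ []       f g = refl
∑-+ (x ∷ xs) f g = trans (cong (f x +ℚ g x +ℚ_) (∑-+ xs f g)) (+-interchange (f x) (g x) _ _)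

∑-*ˡ : ∀ xs c (f : A → ℚ) → ∑[ x ∈ xs ] (c *ℚ f x) ≡ c *ℚ ∑ xs f
∑-*ˡ []       c f = sym (ℚ.*-zeroʳ c)
∑-*ˡ (x ∷ xs) c f = trans (cong (c *ℚ f x +ℚ_) (∑-*ˡ xs c f)) (sym (ℚ.*-distribˡ-+ c (f x) _))

∑-++ : ∀ xs ys (f : A → ℚ) → ∑ (xs ++ ys) f ≡ ∑ xs f +ℚ ∑ ys f
∑-++ []       ys f = sym (ℚ.+-identityˡ _)
∑-++ (x ∷ xs) ys f = trans (cong (f x +ℚ_) (∑-++ xs ys f)) (sym (ℚ.+-assoc (f x) _ _))

∑-if : ∀ b xs (f : A → ℚ) → ∑[ x ∈ xs ] (if b then f x else 0ℚ) ≡ (if b then ∑ xs f else 0ℚ)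
∑-if true  xs f = refl
∑-if false xs f = ∑-zero xs

∑-⊗ : ∀ xs yss (T : List A → ℚ) (f : A → ℚ) (g : List A → ℚ) → (∀ x ys → T (x ∷ ys) ≡ f x *ℚ g ys) →
      ∑ (xs ⊗ yss) T ≡ ∑ xs f *ℚ ∑ yss g
∑-⊗ []       yss T f g split = sym (ℚ.*-zeroˡ (∑ yss g))
∑-⊗ (x ∷ xs) yss T f g split = begin
  ∑ (map (x ∷_) yss ++ xs ⊗ yss) T                ≡⟨ ∑-++ (map (x ∷_) yss) (xs ⊗ yss) T ⟩
  ∑ (map (x ∷_) yss) T +ℚ ∑ (xs ⊗ yss) T         ≡⟨ cong₂ _+ℚ_ head (∑-⊗ xs yss T f g split) ⟩
  f x *ℚ ∑ yss g +ℚ ∑ xs f *ℚ ∑ yss g             ≡⟨ sym (ℚ.*-distribʳ-+ (∑ yss g) (f x) _) ⟩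
  (f x +ℚ ∑ xs f) *ℚ ∑ yss g                      ∎
  where
  open ≡-Reasoning
  head : ∑ (map (x ∷_) yss) T ≡ f x *ℚ ∑ yss g
  head = trans (∑-map yss (x ∷_) T) (trans (∑-cong yss (split x)) (∑-*ˡ yss (f x) g))

All-⊗ : ∀ {P : A → Set} {Q R : List A → Set} {xs yss} → All P xs → All Q yss →
        (∀ {x ys} → P x → Q ys → R (x ∷ ys)) → All R (xs ⊗ yss)
All-⊗ ps qs combine = All.concat⁺ (All.map⁺ (All.map (λ p → All.map⁺ (All.map (combine p) qs)) ps))

∑-upTo : ∀ n f → ∑ (upTo n) f ≡ ∑< n f
∑-upTo zero    f = refl
∑-upTo (suc n) f = begin
  ∑ (upTo (suc n)) f         ≡⟨ cong (λ xs → ∑ xs f) (sym (List.upTo-∷ʳ n)) ⟩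
  ∑ (upTo n ∷ʳ n) f          ≡⟨ ∑-++ (upTo n) (n ∷ []) f ⟩
  ∑ (upTo n) f +ℚ (f n +ℚ 0ℚ) ≡⟨ cong₂ _+ℚ_ (∑-upTo n f) (ℚ.+-identityʳ (f n)) ⟩
  ∑< n f +ℚ f n              ∎
  where open ≡-Reasoning

∑<-cong : ∀ n {f g} → (∀ k → k < n → f k ≡ g k) → ∑< n f ≡ ∑< n g
∑<-cong zero    eq = refl
∑<-cong (suc n) eq = cong₂ _+ℚ_ (∑<-cong n λ k k<n → eq k (ℕ.m<n⇒m<1+n k<n)) (eq n ℕ.≤-refl)

∑<-zero : ∀ n {f} → (∀ k → k < n → f k ≡ 0ℚ) → ∑< n f ≡ 0ℚ
∑<-zero zero    vanish = refl
∑<-zero (suc n) vanish =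
  cong₂ _+ℚ_ (∑<-zero n λ k k<n → vanish k (ℕ.m<n⇒m<1+n k<n)) (vanish n ℕ.≤-refl)

∑<-extend : ∀ {n N} f → n ≤ N → (∀ k → n ≤ k → k < N → f k ≡ 0ℚ) → ∑< N f ≡ ∑< n f
∑<-extend {N = zero}  f z≤n vanish = refl
∑<-extend {N = suc N} f n≤N vanish with ℕ.m≤n⇒m<n∨m≡n n≤N
... | inj₂ refl = refl
... | inj₁ n≤N′ = trans
  (cong₂ _+ℚ_ (∑<-extend f (ℕ.≤-pred n≤N′) λ k n≤k k<N → vanish k n≤k (ℕ.m<n⇒m<1+n k<N))
              (vanish N (ℕ.≤-pred n≤N′) ℕ.≤-refl))
  (ℚ.+-identityʳ _)

∑<-last : ∀ n {f} → (∀ k → k < n → f k ≡ 0ℚ) → ∑< (suc n) f ≡ f n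
∑<-last n {f} vanish = trans (cong (_+ℚ f n) (∑<-zero n vanish)) (ℚ.+-identityˡ (f n))

∑<-point : ∀ {n} f p → p < n → (∀ k → k < n → k ≢ p → f k ≡ 0ℚ) → ∑< n f ≡ f p
∑<-point {n} f p p<n vanish = begin
  ∑< n f         ≡⟨ ∑<-extend f p<n (λ k p<k k<n → vanish k k<n (ℕ.<⇒≢ p<k ∘ sym)) ⟩
  ∑< (suc p) f   ≡⟨ ∑<-last p (λ k k<p → vanish k (ℕ.<-trans k<p p<n) (ℕ.<⇒≢ k<p)) ⟩
  f p            ∎
  where open ≡-Reasoning

∑<-∑-swap : ∀ n xs (G : ℕ → A → ℚ) → ∑[ k < n ] ∑ xs (G k) ≡ ∑[ x ∈ xs ] ∑[ k < n ] G k x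
∑<-∑-swap zero    xs G = sym (∑-zero xs)
∑<-∑-swap (suc n) xs G =
  trans (cong (_+ℚ ∑ xs (G n)) (∑<-∑-swap n xs G)) (sym (∑-+ xs (λ x → ∑[ k < n ] G k x) (G n)))

sumS-∑< : ∀ n F e → sumS n F e ≡ ∑[ k < n ] F k e
sumS-∑< zero    F e = refl
sumS-∑< (suc n) F e = cong (_+ℚ F n e) (sumS-∑< n F e)

foldr-unique : (F : List ℚ → ℚ) → F [] ≡ 0ℚ → (∀ x xs → F (x ∷ xs) ≡ x +ℚ F xs) →
               ∀ xs → F xs ≡ foldr _+ℚ_ 0ℚ xs
foldr-unique F nil cons []       = nil
foldr-unique F nil cons (x ∷ xs) = trans (cons x xs) (cong (x +ℚ_) (foldr-unique F nil cons xs))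

-- The helpers local to the where-blocks of _⊛_ and exactDiv are out of
-- scope; the metas below are solved to them by unification.
mutual
  ⊛-fold : Series → Series → Mono → List ℚ → ℚ
  ⊛-fold = _

  ⊛-as-∑ : ∀ f g e → (f ⊛ g) e ≡ ∑[ u ∈ monoDivs e ] (f u *ℚ g (monoSub e u))
  ⊛-as-∑ f g e with map (λ u → f u *ℚ g (monoSub e u)) (monoDivs e)
  ... | xs = foldr-unique (⊛-fold f g e) refl (λ _ _ → refl) xs

mutual
  search : ℕ → ℕ → List ℕ → Maybe ℕ
  search = _

  exactDiv-unfold : ∀ m n → exactDiv m n ≡ (if 0 ≡ᵇ n then just 0 else search m n (applyUpTo suc n))
  exactDiv-unfold m n with applyUpTo suc n
  ... | qs = refl

search-sound : ∀ m n qs {q} → search m n qs ≡ just q → q * m ≡ n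
search-sound m n (x ∷ qs) eq with x * m ≡ᵇ n in x*m≡ᵇn
search-sound m n (x ∷ qs) refl | true  = ℕ.≡ᵇ⇒≡ (x * m) n (subst T (sym x*m≡ᵇn) _)
search-sound m n (x ∷ qs) eq   | false = search-sound m n qs eq

search-complete : ∀ m .{{_ : NonZero m}} {q} qs → q ∈ qs → search m (q * m) qs ≡ just q
search-complete m {q} (x ∷ qs) q∈ with x * m ≡ᵇ q * m in x*m≡ᵇq*m
... | true  = cong just (ℕ.*-cancelʳ-≡ x q m (ℕ.≡ᵇ⇒≡ (x * m) (q * m) (subst T (sym x*m≡ᵇq*m) _)))
search-complete m (x ∷ qs) (there q∈) | false = search-complete m qs q∈
search-complete m (x ∷ qs) (here refl) | false = ⊥-elim (subst T x*m≡ᵇq*m (ℕ.≡⇒≡ᵇ (x * m) (x * m) refl))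

exactDiv-sound : ∀ {m n q} → exactDiv m n ≡ just q → q * m ≡ n
exactDiv-sound {m} {n} eq = search-sound m n (upTo (suc n)) (trans (sym (exactDiv-unfold m n)) eq)

exactDiv-complete : ∀ m .{{_ : NonZero m}} q → exactDiv m (q * m) ≡ just q
exactDiv-complete m q = trans (exactDiv-unfold m (q * m))
  (search-complete m (upTo (suc (q * m))) (∈-upTo⁺ (s≤s (ℕ.m≤m*n q m))))

-- Coefficient sequences: φ ↑ m and α ∗ β are those of φ(tᵐ) and α(t)β(t).

_↑_ : (ℕ → ℚ) → ℕ → ℕ → ℚ
(φ ↑ m) n = maybe′ φ 0ℚ (exactDiv m n)

↑-multiple : ∀ φ m .{{_ : NonZero m}} q → (φ ↑ m) (q * m) ≡ φ q
↑-multiple φ m q = cong (maybe′ φ 0ℚ) (exactDiv-complete m q)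

↑-nonmultiple : ∀ φ m {n} → m ∤ n → (φ ↑ m) n ≡ 0ℚ
↑-nonmultiple φ m {n} m∤n with exactDiv m n in eq
... | just q  = ⊥-elim (m∤n (divides q (sym (exactDiv-sound eq))))
... | nothing = refl

↑-cong : ∀ {φ ψ} m → φ ≗ ψ → φ ↑ m ≗ ψ ↑ m
↑-cong m φ≗ψ n with exactDiv m n
... | just q  = φ≗ψ q
... | nothing = refl

↑-* : ∀ φ a b .{{_ : NonZero a}} .{{_ : NonZero b}} → φ ↑ (a * b) ≗ (φ ↑ a) ↑ b
↑-* φ a b n with b ∣? n
... | no b∤n = trans (↑-nonmultiple φ (a * b) (b∤n ∘ ∣-trans (n∣m*n a))) (sym (↑-nonmultiple (φ ↑ a) b b∤n))
... | yes (divides-refl y) with a ∣? y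
...   | yes (divides-refl z) = begin
  (φ ↑ (a * b)) (z * a * b)   ≡⟨ cong (φ ↑ (a * b)) (ℕ.*-assoc z a b) ⟩
  (φ ↑ (a * b)) (z * (a * b)) ≡⟨ ↑-multiple φ (a * b) {{ℕ.m*n≢0 a b}} z ⟩
  φ z                         ≡⟨ ↑-multiple φ a z ⟨
  (φ ↑ a) (z * a)             ≡⟨ ↑-multiple (φ ↑ a) b (z * a) ⟨
  ((φ ↑ a) ↑ b) (z * a * b)   ∎
  where open ≡-Reasoning
...   | no a∤y = trans (↑-nonmultiple φ (a * b) (a∤y ∘ *-cancelʳ-∣ b))
                       (sym (trans (↑-multiple (φ ↑ a) b y) (↑-nonmultiple φ a a∤y)))

_∗_ : (ℕ → ℚ) → (ℕ → ℚ) → ℕ → ℚ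
(α ∗ β) n = ∑[ x < suc n ] (α x *ℚ β (n ∸ x))

∗-congˡ : ∀ {α α′} β → α ≗ α′ → α ∗ β ≗ α′ ∗ β
∗-congˡ β α≗α′ n = ∑<-cong (suc n) λ x _ → cong (_*ℚ β (n ∸ x)) (α≗α′ x)

∤-between-multiples : ∀ {m q n} → q * m < n → n < suc q * m → m ∤ n
∤-between-multiples {m} {q} q*m<n n<sq*m (divides-refl y) =
  ℕ.<⇒≱ (ℕ.*-cancelʳ-< m q y q*m<n) (ℕ.<⇒≤pred (ℕ.*-cancelʳ-< m y (suc q) n<sq*m))

∑<-multiples : ∀ m .{{_ : NonZero m}} f → (∀ n → m ∤ n → f n ≡ 0ℚ) →
               ∀ q r → r < m → ∑< (suc (r + q * m)) f ≡ ∑[ y < suc q ] f (y * m)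
∑<-multiples m@(suc m′) f vanish q r r<m = trans (skip q r r<m) (go q)
  where
  skip : ∀ q r → r < m → ∑< (suc (r + q * m)) f ≡ ∑< (suc (q * m)) f
  skip q r r<m = ∑<-extend f (s≤s (ℕ.m≤n+m (q * m) r)) λ n q*m<n n≤r+q*m →
    vanish n (∤-between-multiples {q = q} q*m<n (ℕ.<-≤-trans n≤r+q*m (ℕ.+-monoˡ-≤ (q * m) r<m)))
  go : ∀ q → ∑< (suc (q * m)) f ≡ ∑[ y < suc q ] f (y * m)
  go zero    = refl
  -- suc q * m unfolds to suc (m′ + q * m).
  go (suc q) = cong (_+ℚ f (suc q * m)) (trans (skip q m′ ℕ.≤-refl) (go q))

↑-∗-reindex : ∀ α β m .{{_ : NonZero m}} q r → r < m →
              ((α ↑ m) ∗ β) (r + q * m) ≡ ∑[ y < suc q ] (α y *ℚ β (r + (q ∸ y) * m))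
↑-∗-reindex α β m q r r<m = begin
  ((α ↑ m) ∗ β) (r + q * m)                                   ≡⟨ ∑<-multiples m _ vanish q r r<m ⟩
  ∑[ y < suc q ] ((α ↑ m) (y * m) *ℚ β (r + q * m ∸ y * m))  ≡⟨ ∑<-cong (suc q) term ⟩
  ∑[ y < suc q ] (α y *ℚ β (r + (q ∸ y) * m))                 ∎
  where
  open ≡-Reasoning
  vanish : ∀ x → m ∤ x → (α ↑ m) x *ℚ β (r + q * m ∸ x) ≡ 0ℚ
  vanish x m∤x = *-vanishˡ _ (↑-nonmultiple α m m∤x)
  term : ∀ y → y < suc q → (α ↑ m) (y * m) *ℚ β (r + q * m ∸ y * m) ≡ α y *ℚ β (r + (q ∸ y) * m)
  term y y<sq = cong₂ _*ℚ_ (↑-multiple α m y) (cong β (begin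
    r + q * m ∸ y * m    ≡⟨ ℕ.+-∸-assoc r (ℕ.*-monoˡ-≤ m (ℕ.≤-pred y<sq)) ⟩
    r + (q * m ∸ y * m)  ≡⟨ cong (r +_) (ℕ.*-distribʳ-∸ m q y) ⟨
    r + (q ∸ y) * m      ∎))

↑-∗ : ∀ α β m .{{_ : NonZero m}} → (α ↑ m) ∗ (β ↑ m) ≗ (α ∗ β) ↑ m
↑-∗ α β m n with m ∣? n
... | yes (divides-refl q) = begin
  ((α ↑ m) ∗ (β ↑ m)) (q * m)                   ≡⟨ ↑-∗-reindex α (β ↑ m) m q 0 (>-nonZero⁻¹ m) ⟩
  ∑[ y < suc q ] (α y *ℚ (β ↑ m) ((q ∸ y) * m)) ≡⟨ ∑<-cong (suc q) (λ y _ → cong (α y *ℚ_) (↑-multiple β m (q ∸ y))) ⟩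
  (α ∗ β) q                                     ≡⟨ ↑-multiple (α ∗ β) m q ⟨
  ((α ∗ β) ↑ m) (q * m)                         ∎
  where open ≡-Reasoning
... | no m∤n = trans (∑<-zero (suc n) vanish) (sym (↑-nonmultiple (α ∗ β) m m∤n))
  where
  vanish : ∀ x → x < suc n → (α ↑ m) x *ℚ (β ↑ m) (n ∸ x) ≡ 0ℚ
  vanish x x≤n with m ∣? x
  ... | no m∤x  = *-vanishˡ {(α ↑ m) x} _ (↑-nonmultiple α m m∤x)
  ... | yes m∣x = *-vanishʳ ((α ↑ m) x) (↑-nonmultiple β m λ m∣n∸x → m∤n (∣m∸n∣n⇒∣m m (ℕ.≤-pred x≤n) m∣n∸x m∣x))

-- Products over all variables: weight φ e is the coefficient of the monomial e
-- in ∏_{i,j} Σₐ φ(a) x_{i,j}^a.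

rowWeight : (ℕ → ℚ) → List ℕ → ℚ
rowWeight φ []       = 1ℚ
rowWeight φ (n ∷ ns) = φ n *ℚ rowWeight φ ns

weight : (ℕ → ℚ) → Mono → ℚ
weight φ []       = 1ℚ
weight φ (r ∷ rs) = rowWeight φ r *ℚ weight φ rs

graded : (ℕ → ℚ) → ℕ → Series
graded φ d e = if does (deg e ≟ d) then weight φ e else 0ℚ

rowWeight-↑ : ∀ φ M r → rowWeight (φ ↑ M) r ≡ maybe′ (rowWeight φ) 0ℚ (rowDiv M r)
rowWeight-↑ φ M []       = refl
rowWeight-↑ φ M (n ∷ ns) with exactDiv M n | rowDiv M ns | rowWeight-↑ φ M ns
... | just q  | just qs | ih = cong (φ q *ℚ_) ih
... | just q  | nothing | ih = *-vanishʳ (φ q) ih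
... | nothing | _       | _  = ℚ.*-zeroˡ (rowWeight (φ ↑ M) ns)

weight-↑ : ∀ φ M e → weight (φ ↑ M) e ≡ maybe′ (weight φ) 0ℚ (monoDiv M e)
weight-↑ φ M []       = refl
weight-↑ φ M (r ∷ rs) with rowDiv M r | monoDiv M rs | rowWeight-↑ φ M r | weight-↑ φ M rs
... | just u  | just us | eq | ih = cong₂ _*ℚ_ eq ih
... | just u  | nothing | eq | ih = *-vanishʳ (rowWeight (φ ↑ M) r) ih
... | nothing | _       | eq | _  = *-vanishˡ _ eq

sum-rowDiv : ∀ M r {v} → rowDiv M r ≡ just v → sum r ≡ sum v * M
sum-rowDiv M []       refl = refl
sum-rowDiv M (n ∷ ns) eq with exactDiv M n in n≡ | rowDiv M ns in ns≡
sum-rowDiv M (n ∷ ns) refl | just q  | just qs =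
  trans (cong₂ _+_ (sym (exactDiv-sound n≡)) (sum-rowDiv M ns ns≡)) (sym (ℕ.*-distribʳ-+ M q (sum qs)))
sum-rowDiv M (n ∷ ns) () | just q  | nothing
sum-rowDiv M (n ∷ ns) () | nothing | _

degFrom-monoDiv : ∀ M e {v} → monoDiv M e ≡ just v → ∀ i → degFrom i e ≡ degFrom i v * M
degFrom-monoDiv M []       refl i = refl
degFrom-monoDiv M (r ∷ rs) eq i with rowDiv M r in r≡ | monoDiv M rs in rs≡
degFrom-monoDiv M (r ∷ rs) refl i | just u  | just us = begin
  i * sum r + degFrom (suc i) rs                ≡⟨ cong₂ (λ s t → i * s + t) (sum-rowDiv M r r≡) (degFrom-monoDiv M rs rs≡ (suc i)) ⟩
  i * (sum u * M) + degFrom (suc i) us * M      ≡⟨ cong (_+ degFrom (suc i) us * M) (ℕ.*-assoc i (sum u) M) ⟨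
  i * sum u * M + degFrom (suc i) us * M        ≡⟨ ℕ.*-distribʳ-+ M (i * sum u) _ ⟨
  (i * sum u + degFrom (suc i) us) * M          ∎
  where open ≡-Reasoning
degFrom-monoDiv M (r ∷ rs) () i | just u  | nothing
degFrom-monoDiv M (r ∷ rs) () i | nothing | _

weight-↑-vanishes : ∀ φ M e → M ∤ deg e → weight (φ ↑ M) e ≡ 0ℚ
weight-↑-vanishes φ M e M∤e with monoDiv M e in e≡ | weight-↑ φ M e
... | just v  | _   = ⊥-elim (M∤e (divides (deg v) (degFrom-monoDiv M e e≡ 1)))
... | nothing | W≡0 = W≡0

≟-*-cancelʳ : ∀ a b m .{{_ : NonZero m}} → does (a * m ≟ b * m) ≡ does (a ≟ b)
≟-*-cancelʳ a b m with a ≟ b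
... | yes refl = trans (dec-true (a * m ≟ a * m) refl) (sym (dec-true (a ≟ a) refl))
... | no a≢b   = trans (dec-false (a * m ≟ b * m) (a≢b ∘ ℕ.*-cancelʳ-≡ a b m)) (sym (dec-false (a ≟ b) a≢b))

graded-multiple : ∀ φ M .{{_ : NonZero M}} k e {b} → deg e ≡ b * M →
                  graded φ (k * M) e ≡ (if does (b ≟ k) then weight φ e else 0ℚ)
graded-multiple φ M k e {b} e≡ =
  cong (λ t → if t then weight φ e else 0ℚ) (trans (cong (λ n → does (n ≟ k * M)) e≡) (≟-*-cancelʳ b k M))

pleth-graded : ∀ {F} φ M .{{_ : NonZero M}} k → F ≈S graded φ k → pleth M F ≈S graded (φ ↑ M) (k * M)
pleth-graded φ M k F≈ e with monoDiv M e in e≡ | weight-↑ φ M e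
... | just v  | W≡  = trans (F≈ v) (sym (trans (graded-multiple (φ ↑ M) M k e {deg v} (degFrom-monoDiv M e e≡ 1))
                                              (cong (λ w → if does (deg v ≟ k) then w else 0ℚ) W≡)))
... | nothing | W≡0 = sym (if-vanish (does (deg e ≟ k * M)) W≡0)

rowWeight-∗ : ∀ {α β γ} → α ∗ β ≗ γ → ∀ r →
              ∑[ u ∈ rowDivs r ] (rowWeight α u *ℚ rowWeight β (zipWith _∸_ r u)) ≡ rowWeight γ r
rowWeight-∗ αβ≗γ []       = refl
rowWeight-∗ {α} {β} {γ} αβ≗γ (a ∷ as) = begin
  ∑ (upTo (suc a) ⊗ rowDivs as) W                      ≡⟨ ∑-⊗ (upTo (suc a)) (rowDivs as) W f g split ⟩
  ∑ (upTo (suc a)) f *ℚ ∑ (rowDivs as) g               ≡⟨ cong₂ _*ℚ_ (trans (∑-upTo (suc a) f) (αβ≗γ a)) (rowWeight-∗ αβ≗γ as) ⟩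
  γ a *ℚ rowWeight γ as                                ∎
  where
  open ≡-Reasoning
  W : List ℕ → ℚ
  W u = rowWeight α u *ℚ rowWeight β (zipWith _∸_ (a ∷ as) u)
  f : ℕ → ℚ
  f x = α x *ℚ β (a ∸ x)
  g : List ℕ → ℚ
  g u = rowWeight α u *ℚ rowWeight β (zipWith _∸_ as u)
  split : ∀ x u → W (x ∷ u) ≡ f x *ℚ g u
  split x u = *-interchange (α x) (rowWeight α u) (β (a ∸ x)) (rowWeight β (zipWith _∸_ as u))

weight-∗ : ∀ {α β γ} → α ∗ β ≗ γ → ∀ e →
           ∑[ u ∈ monoDivs e ] (weight α u *ℚ weight β (monoSub e u)) ≡ weight γ e
weight-∗ αβ≗γ []       = refl
weight-∗ {α} {β} {γ} αβ≗γ (r ∷ rs) =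
  trans (∑-⊗ (rowDivs r) (monoDivs rs) _ _ _ split) (cong₂ _*ℚ_ (rowWeight-∗ αβ≗γ r) (weight-∗ αβ≗γ rs))
  where
  split : ∀ u us → weight α (u ∷ us) *ℚ weight β (monoSub (r ∷ rs) (u ∷ us))
                 ≡ (rowWeight α u *ℚ rowWeight β (zipWith _∸_ r u)) *ℚ (weight α us *ℚ weight β (monoSub rs us))
  split u us = *-interchange (rowWeight α u) (weight α us) (rowWeight β (zipWith _∸_ r u)) (weight β (monoSub rs us))

rowDivs-complement-sum : ∀ r → All (λ u → sum u + sum (zipWith _∸_ r u) ≡ sum r) (rowDivs r)
rowDivs-complement-sum []       = refl ∷ []
rowDivs-complement-sum (a ∷ as) = All-⊗ (All.applyUpTo⁺₁ id (suc a) ℕ.≤-pred) (rowDivs-complement-sum as) combine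
  where
  combine : ∀ {x u} → x ≤ a → sum u + sum (zipWith _∸_ as u) ≡ sum as →
            x + sum u + (a ∸ x + sum (zipWith _∸_ as u)) ≡ a + sum as
  combine {x} {u} x≤a eq = trans (ℕ-+-interchange x (sum u) (a ∸ x) _) (cong₂ _+_ (ℕ.m+[n∸m]≡n x≤a) eq)

monoDivs-complement-degFrom : ∀ e → All (λ u → ∀ i → degFrom i u + degFrom i (monoSub e u) ≡ degFrom i e) (monoDivs e)
monoDivs-complement-degFrom []       = (λ i → refl) ∷ []
monoDivs-complement-degFrom (r ∷ rs) = All-⊗ (rowDivs-complement-sum r) (monoDivs-complement-degFrom rs) combine
  where
  combine : ∀ {u us} → sum u + sum (zipWith _∸_ r u) ≡ sum r →
            (∀ i → degFrom i us + degFrom i (monoSub rs us) ≡ degFrom i rs) →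
            ∀ i → degFrom i (u ∷ us) + degFrom i (monoSub (r ∷ rs) (u ∷ us)) ≡ degFrom i (r ∷ rs)
  combine {u} {us} eq eqs i = begin
    i * sum u + degFrom (suc i) us + (i * sum (zipWith _∸_ r u) + degFrom (suc i) (monoSub rs us))
      ≡⟨ ℕ-+-interchange (i * sum u) _ _ _ ⟩
    i * sum u + i * sum (zipWith _∸_ r u) + (degFrom (suc i) us + degFrom (suc i) (monoSub rs us))
      ≡⟨ cong₂ _+_ (trans (sym (ℕ.*-distribˡ-+ i (sum u) _)) (cong (i *_) eq)) (eqs (suc i)) ⟩
    i * sum r + degFrom (suc i) rs
      ∎
    where open ≡-Reasoning

monoDivs-complement-deg : ∀ e → All (λ u → deg u + deg (monoSub e u) ≡ deg e) (monoDivs e)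
monoDivs-complement-deg e = All.map (λ eq → eq 1) (monoDivs-complement-degFrom e)

-- Sorting the convolution by degree

m≤⌊n/2⌋⇒2*m≤n : ∀ {m} n → m ≤ ⌊ n /2⌋ → 2 * m ≤ n
m≤⌊n/2⌋⇒2*m≤n {m} n m≤⌊n/2⌋ = begin
  2 * m               ≤⟨ ℕ.*-monoʳ-≤ 2 m≤⌊n/2⌋ ⟩
  2 * ⌊ n /2⌋         ≡⟨ cong (⌊ n /2⌋ +_) (ℕ.+-identityʳ _) ⟩
  ⌊ n /2⌋ + ⌊ n /2⌋   ≤⟨ ℕ.+-monoʳ-≤ ⌊ n /2⌋ (ℕ.⌊n/2⌋≤⌈n/2⌉ n) ⟩
  ⌊ n /2⌋ + ⌈ n /2⌉   ≡⟨ ℕ.⌊n/2⌋+⌈n/2⌉≡n n ⟩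
  n                   ∎
  where open ℕ.≤-Reasoning

2*m≤n⇒m≤⌊n/2⌋ : ∀ {m n} → 2 * m ≤ n → m ≤ ⌊ n /2⌋
2*m≤n⇒m≤⌊n/2⌋ {m} {n} 2*m≤n = subst (_≤ ⌊ n /2⌋) (sym (ℕ.n≡⌊n+n/2⌋ m))
  (ℕ.⌊n/2⌋-mono (subst (_≤ n) (cong (m +_) (ℕ.+-identityʳ m)) 2*m≤n))

∑<-collapse : ∀ d b c (x y : ℚ) →
  ∑[ k < suc ⌊ d /2⌋ ] ((if does (b ≟ k) then x else 0ℚ) *ℚ (if does (c ≟ d ∸ 2 * k) then y else 0ℚ))
  ≡ (if does (2 * b + c ≟ d) then x *ℚ y else 0ℚ)
∑<-collapse d b c x y with 2 * b + c ≟ d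
... | yes refl = trans (∑<-point _ b (s≤s (2*m≤n⇒m≤⌊n/2⌋ (ℕ.m≤m+n (2 * b) c))) off)
                       (trans on (sym (if-yes (2 * b + c ≟ 2 * b + c) refl (x *ℚ y))))
  where
  off : ∀ k → k < suc ⌊ 2 * b + c /2⌋ → k ≢ b →
        (if does (b ≟ k) then x else 0ℚ) *ℚ (if does (c ≟ 2 * b + c ∸ 2 * k) then y else 0ℚ) ≡ 0ℚ
  off k _ k≢b = *-vanishˡ _ (if-no (b ≟ k) (k≢b ∘ sym) x)
  on : (if does (b ≟ b) then x else 0ℚ) *ℚ (if does (c ≟ 2 * b + c ∸ 2 * b) then y else 0ℚ) ≡ x *ℚ y
  on = cong₂ _*ℚ_ (if-yes (b ≟ b) refl x) (if-yes (c ≟ _) (sym (ℕ.m+n∸m≡n (2 * b) c)) y)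
... | no 2b+c≢d = trans (∑<-zero _ vanish) (sym (if-no (2 * b + c ≟ d) 2b+c≢d (x *ℚ y)))
  where
  vanish : ∀ k → k < suc ⌊ d /2⌋ →
           (if does (b ≟ k) then x else 0ℚ) *ℚ (if does (c ≟ d ∸ 2 * k) then y else 0ℚ) ≡ 0ℚ
  vanish k k<N with b ≟ k
  ... | no b≢k  = *-vanishˡ _ (if-no (b ≟ k) b≢k x)
  ... | yes refl = *-vanishʳ (if does (b ≟ b) then x else 0ℚ) (if-no (c ≟ d ∸ 2 * b) (λ c≡ → 2b+c≢d
        (trans (cong (2 * b +_) c≡) (ℕ.m+[n∸m]≡n (m≤⌊n/2⌋⇒2*m≤n d (ℕ.≤-pred k<N))))) y)

module _ (m : ℕ) .{{_ : NonZero m}} where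

  private instance
    2m≢0 : NonZero (2 * m)
    2m≢0 = ℕ.m*n≢0 2 m

  ∗-identity-↑ : ∀ {φ ψ χ} → (φ ↑ 2) ∗ ψ ≗ χ → (φ ↑ (2 * m)) ∗ (ψ ↑ m) ≗ χ ↑ m
  ∗-identity-↑ {φ} {ψ} {χ} φ₂ψ≗χ n = begin
    ((φ ↑ (2 * m)) ∗ (ψ ↑ m)) n   ≡⟨ ∗-congˡ (ψ ↑ m) (↑-* φ 2 m) n ⟩
    (((φ ↑ 2) ↑ m) ∗ (ψ ↑ m)) n   ≡⟨ ↑-∗ (φ ↑ 2) ψ m n ⟩
    (((φ ↑ 2) ∗ ψ) ↑ m) n         ≡⟨ ↑-cong m φ₂ψ≗χ n ⟩
    (χ ↑ m) n                     ∎
    where open ≡-Reasoning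

  ∑<-graded-collapse : ∀ φ ψ d u w →
    ∑[ k < suc ⌊ d /2⌋ ] (graded (φ ↑ (2 * m)) (k * (2 * m)) u *ℚ graded (ψ ↑ m) ((d ∸ 2 * k) * m) w)
    ≡ (if does (deg u + deg w ≟ d * m) then weight (φ ↑ (2 * m)) u *ℚ weight (ψ ↑ m) w else 0ℚ)
  ∑<-graded-collapse φ ψ d u w with 2 * m ∣? deg u | m ∣? deg w
  ... | no 2m∤u | _ = trans
    (∑<-zero (suc ⌊ d /2⌋) λ k _ → *-vanishˡ _ (if-vanish (does (deg u ≟ k * (2 * m))) Wu≡0))
    (sym (if-vanish (does (deg u + deg w ≟ d * m)) (*-vanishˡ _ Wu≡0)))
    where
    Wu≡0 : weight (φ ↑ (2 * m)) u ≡ 0ℚ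
    Wu≡0 = weight-↑-vanishes φ (2 * m) u 2m∤u
  ... | yes _ | no m∤w = trans
    (∑<-zero (suc ⌊ d /2⌋) λ k _ → *-vanishʳ (graded (φ ↑ (2 * m)) (k * (2 * m)) u)
                                      (if-vanish (does (deg w ≟ (d ∸ 2 * k) * m)) Ww≡0))
    (sym (if-vanish (does (deg u + deg w ≟ d * m)) (*-vanishʳ (weight (φ ↑ (2 * m)) u) Ww≡0)))
    where
    Ww≡0 : weight (ψ ↑ m) w ≡ 0ℚ
    Ww≡0 = weight-↑-vanishes ψ m w m∤w
  ... | yes (divides b u≡) | yes (divides c w≡) = begin
    ∑[ k < suc ⌊ d /2⌋ ] (graded α (k * (2 * m)) u *ℚ graded β ((d ∸ 2 * k) * m) w)
      ≡⟨ ∑<-cong (suc ⌊ d /2⌋) (λ k _ → cong₂ _*ℚ_ (graded-multiple α (2 * m) k u {b} u≡) (graded-multiple β m (d ∸ 2 * k) w {c} w≡)) ⟩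
    ∑[ k < suc ⌊ d /2⌋ ] ((if does (b ≟ k) then weight α u else 0ℚ) *ℚ (if does (c ≟ d ∸ 2 * k) then weight β w else 0ℚ))
      ≡⟨ ∑<-collapse d b c _ _ ⟩
    (if does (2 * b + c ≟ d) then weight α u *ℚ weight β w else 0ℚ)
      ≡⟨ cong (λ t → if t then weight α u *ℚ weight β w else 0ℚ) degrees ⟨
    (if does (deg u + deg w ≟ d * m) then weight α u *ℚ weight β w else 0ℚ)
      ∎
    where
    open ≡-Reasoning
    α β : ℕ → ℚ
    α = φ ↑ (2 * m)
    β = ψ ↑ m
    degrees : does (deg u + deg w ≟ d * m) ≡ does (2 * b + c ≟ d)
    degrees = trans (cong (λ n → does (n ≟ d * m)) (begin
      deg u + deg w            ≡⟨ cong₂ _+_ u≡ w≡ ⟩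
      b * (2 * m) + c * m      ≡⟨ cong (_+ c * m) (trans (sym (ℕ.*-assoc b 2 m)) (cong (_* m) (ℕ.*-comm b 2))) ⟩
      2 * b * m + c * m        ≡⟨ ℕ.*-distribʳ-+ m (2 * b) c ⟨
      (2 * b + c) * m          ∎)) (≟-*-cancelʳ (2 * b + c) d m)

  pleth-≈S-conv : ∀ {A B C : ℕ → Series} {φ ψ χ : ℕ → ℚ} →
    (∀ k → A k ≈S graded φ k) → (∀ k → B k ≈S graded ψ k) → (∀ k → C k ≈S graded χ k) →
    (φ ↑ 2) ∗ ψ ≗ χ → ∀ d → pleth m (C d) ≈S conv A B d m
  pleth-≈S-conv {A} {B} {C} {φ} {ψ} {χ} A≈ B≈ C≈ φ₂ψ≗χ d e = begin
    pleth m (C d) e                                                ≡⟨ pleth-graded χ m d (C≈ d) e ⟩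
    (if D then weight (χ ↑ m) e else 0ℚ)                           ≡⟨ cong (λ w → if D then w else 0ℚ) (weight-∗ (∗-identity-↑ φ₂ψ≗χ) e) ⟨
    (if D then ∑ (monoDivs e) W else 0ℚ)                           ≡⟨ ∑-if D (monoDivs e) W ⟨
    ∑[ u ∈ monoDivs e ] (if D then W u else 0ℚ)                    ≡⟨ ∑-cong-All (All.map collapse (monoDivs-complement-deg e)) ⟨
    ∑[ u ∈ monoDivs e ] ∑[ k < N ] term k u                        ≡⟨ ∑<-∑-swap N (monoDivs e) term ⟨
    ∑[ k < N ] ∑[ u ∈ monoDivs e ] term k u                        ≡⟨ ∑<-cong N (λ k _ → product k) ⟨
    ∑[ k < N ] (pleth (2 * m) (A k) ⊛ pleth m (B (d ∸ 2 * k))) e   ≡⟨ sumS-∑< N _ e ⟨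
    conv A B d m e                                                 ∎
    where
    open ≡-Reasoning
    N : ℕ
    N = suc ⌊ d /2⌋
    D : Bool
    D = does (deg e ≟ d * m)
    W : Mono → ℚ
    W u = weight (φ ↑ (2 * m)) u *ℚ weight (ψ ↑ m) (monoSub e u)
    term : ℕ → Mono → ℚ
    term k u = graded (φ ↑ (2 * m)) (k * (2 * m)) u *ℚ graded (ψ ↑ m) ((d ∸ 2 * k) * m) (monoSub e u)
    collapse : ∀ {u} → deg u + deg (monoSub e u) ≡ deg e → ∑[ k < N ] term k u ≡ (if D then W u else 0ℚ)
    collapse {u} deg≡ = trans (∑<-graded-collapse φ ψ d u (monoSub e u))
                              (cong (λ n → if does (n ≟ d * m) then W u else 0ℚ) deg≡)
    product : ∀ k → (pleth (2 * m) (A k) ⊛ pleth m (B (d ∸ 2 * k))) e ≡ ∑[ u ∈ monoDivs e ] term k u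
    product k = trans (⊛-as-∑ (pleth (2 * m) (A k)) (pleth m (B (d ∸ 2 * k))) e) (∑-cong (monoDivs e) λ u →
      cong₂ _*ℚ_ (pleth-graded φ (2 * m) k (A≈ k) u) (pleth-graded ψ m (d ∸ 2 * k) (B≈ (d ∸ 2 * k)) (monoSub e u)))

-- The four families: wH, wE⁺, wE, sgn are the coefficient sequences of
-- 1/(1-t), 1+t, 1-t, 1/(1+t).

wH : ℕ → ℚ
wH _ = 1ℚ

wE⁺ : ℕ → ℚ
wE⁺ n = if n ≤ᵇ 1 then 1ℚ else 0ℚ

wE : ℕ → ℚ
wE n = if n ≤ᵇ 1 then sgn n else 0ℚ

sgn-+ : ∀ a b → sgn (a + b) ≡ sgn a *ℚ sgn b
sgn-+ zero    b = sym (ℚ.*-identityˡ (sgn b))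
sgn-+ (suc a) b = trans (cong -_ (sgn-+ a b)) (ℚ.neg-distribˡ-* (sgn a) (sgn b))

sgn-even : ∀ k → sgn (k * 2) ≡ 1ℚ
sgn-even zero    = refl
sgn-even (suc k) = trans (-‿involutive (sgn (k * 2))) (sgn-even k)

if-∧ : ∀ a b (x y : ℚ) → (if a ∧ b then x *ℚ y else 0ℚ) ≡ (if a then x else 0ℚ) *ℚ (if b then y else 0ℚ)
if-∧ true  true  x y = refl
if-∧ true  false x y = sym (ℚ.*-zeroʳ x)
if-∧ false b     x y = sym (ℚ.*-zeroˡ (if b then y else 0ℚ))

H-graded : ∀ d → H d ≈S graded wH d
H-graded d e = cong (λ w → if deg e ≡ᵇ d then w else 0ℚ) (sym (weight-wH e))
  where
  rowWeight-wH : ∀ r → rowWeight wH r ≡ 1ℚ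
  rowWeight-wH []       = refl
  rowWeight-wH (n ∷ ns) = cong (1ℚ *ℚ_) (rowWeight-wH ns)
  weight-wH : ∀ e → weight wH e ≡ 1ℚ
  weight-wH []       = refl
  weight-wH (r ∷ rs) = cong₂ _*ℚ_ (rowWeight-wH r) (weight-wH rs)

H⁺-graded : ∀ d → H⁺ d ≈S graded sgn d
H⁺-graded d e = cong (λ w → if deg e ≡ᵇ d then w else 0ℚ) (weight-sgn e)
  where
  rowWeight-sgn : ∀ r → sgn (sum r) ≡ rowWeight sgn r
  rowWeight-sgn []       = refl
  rowWeight-sgn (n ∷ ns) = trans (sgn-+ n (sum ns)) (cong (sgn n *ℚ_) (rowWeight-sgn ns))
  weight-sgn : ∀ e → sgn (totalExp e) ≡ weight sgn e
  weight-sgn []       = refl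
  weight-sgn (r ∷ rs) = trans (sgn-+ (sum r) (totalExp rs)) (cong₂ _*ℚ_ (rowWeight-sgn r) (weight-sgn rs))

E⁺-graded : ∀ d → E⁺ d ≈S graded wE⁺ d
E⁺-graded d e with deg e ≡ᵇ d
... | true  = weight-wE⁺ e
  where
  rowWeight-wE⁺ : ∀ r → (if rowSqfree r then 1ℚ else 0ℚ) ≡ rowWeight wE⁺ r
  rowWeight-wE⁺ []                   = refl
  rowWeight-wE⁺ (zero ∷ ns)          = trans (rowWeight-wE⁺ ns) (sym (ℚ.*-identityˡ _))
  rowWeight-wE⁺ (suc zero ∷ ns)      = trans (rowWeight-wE⁺ ns) (sym (ℚ.*-identityˡ _))
  rowWeight-wE⁺ (suc (suc n) ∷ ns)   = sym (ℚ.*-zeroˡ (rowWeight wE⁺ ns))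
  weight-wE⁺ : ∀ e → (if squarefree e then 1ℚ else 0ℚ) ≡ weight wE⁺ e
  weight-wE⁺ []       = refl
  weight-wE⁺ (r ∷ rs) = trans (if-∧ (rowSqfree r) (squarefree rs) 1ℚ 1ℚ)
                              (cong₂ _*ℚ_ (rowWeight-wE⁺ r) (weight-wE⁺ rs))
... | false = refl

E-graded : ∀ d → E d ≈S graded wE d
E-graded d e with deg e ≡ᵇ d
... | true  = weight-wE e
  where
  rowWeight-wE : ∀ r → (if rowSqfree r then sgn (countNZ r) else 0ℚ) ≡ rowWeight wE r
  rowWeight-wE []                 = refl
  rowWeight-wE (zero ∷ ns)        = trans (rowWeight-wE ns) (sym (ℚ.*-identityˡ _))
  rowWeight-wE (suc zero ∷ ns)    = trans (negate (rowSqfree ns)) (cong (- 1ℚ *ℚ_) (rowWeight-wE ns))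
    where
    negate : ∀ b → (if b then - sgn (countNZ ns) else 0ℚ) ≡ - 1ℚ *ℚ (if b then sgn (countNZ ns) else 0ℚ)
    negate true  = sym (-1*x≈-x _)
    negate false = sym (ℚ.*-zeroʳ (- 1ℚ))
  rowWeight-wE (suc (suc n) ∷ ns) = sym (ℚ.*-zeroˡ (rowWeight wE ns))
  weight-wE : ∀ e → (if squarefree e then sgn (numVars e) else 0ℚ) ≡ weight wE e
  weight-wE []       = refl
  weight-wE (r ∷ rs) = begin
    (if rowSqfree r ∧ squarefree rs then sgn (countNZ r + numVars rs) else 0ℚ)
      ≡⟨ cong (λ s → if rowSqfree r ∧ squarefree rs then s else 0ℚ) (sgn-+ (countNZ r) (numVars rs)) ⟩
    (if rowSqfree r ∧ squarefree rs then sgn (countNZ r) *ℚ sgn (numVars rs) else 0ℚ)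
      ≡⟨ if-∧ (rowSqfree r) (squarefree rs) _ _ ⟩
    (if rowSqfree r then sgn (countNZ r) else 0ℚ) *ℚ (if squarefree rs then sgn (numVars rs) else 0ℚ)
      ≡⟨ cong₂ _*ℚ_ (rowWeight-wE r) (weight-wE rs) ⟩
    rowWeight wE r *ℚ weight wE rs
      ∎
    where open ≡-Reasoning
... | false = refl

by-parity : ∀ {P : ℕ → Set} → (∀ k → P (k * 2)) → (∀ k → P (1 + k * 2)) → ∀ n → P n
by-parity     P-even P-odd zero    = P-even 0
by-parity {P} P-even P-odd (suc n) = by-parity {P ∘ suc} P-odd (P-even ∘ suc) n

wH-↑2-∗ : ∀ ψ → (∀ n → ψ (2 + n) ≡ 0ℚ) → ∀ k r → r < 2 → ((wH ↑ 2) ∗ ψ) (r + k * 2) ≡ ψ r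
wH-↑2-∗ ψ ψ[2+n]≡0 k r r<2 = begin
  ((wH ↑ 2) ∗ ψ) (r + k * 2)                     ≡⟨ ↑-∗-reindex wH ψ 2 k r r<2 ⟩
  ∑[ y < suc k ] (1ℚ *ℚ ψ (r + (k ∸ y) * 2))     ≡⟨ ∑<-last k vanish ⟩
  1ℚ *ℚ ψ (r + (k ∸ k) * 2)                      ≡⟨ ℚ.*-identityˡ _ ⟩
  ψ (r + (k ∸ k) * 2)                            ≡⟨ cong ψ (trans (cong (λ j → r + j * 2) (ℕ.n∸n≡0 k)) (ℕ.+-identityʳ r)) ⟩
  ψ r                                            ∎
  where
  open ≡-Reasoning
  vanish : ∀ y → y < k → 1ℚ *ℚ ψ (r + (k ∸ y) * 2) ≡ 0ℚ
  vanish y y<k = *-vanishʳ 1ℚ (trans (cong ψ (sym (ℕ.m+[n∸m]≡n 2≤n))) (ψ[2+n]≡0 _))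
    where
    2≤n : 2 ≤ r + (k ∸ y) * 2
    2≤n = ℕ.≤-trans (ℕ.*-monoˡ-≤ 2 (ℕ.m<n⇒0<n∸m y<k)) (ℕ.m≤n+m _ r)

wE-↑2-∗ : ∀ ψ n → ((wE ↑ 2) ∗ ψ) (2 + n) ≡ ψ (2 + n) -ℚ ψ n
wE-↑2-∗ ψ = by-parity (λ k → step k 0 (s≤s z≤n)) (λ k → step k 1 (s≤s (s≤s z≤n)))
  where
  step : ∀ k r → r < 2 → ((wE ↑ 2) ∗ ψ) (r + suc k * 2) ≡ ψ (r + suc k * 2) -ℚ ψ (r + k * 2)
  step k r r<2 = begin
    ((wE ↑ 2) ∗ ψ) (r + suc k * 2)                       ≡⟨ ↑-∗-reindex wE ψ 2 (suc k) r r<2 ⟩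
    ∑[ y < 2 + k ] (wE y *ℚ ψ (r + (suc k ∸ y) * 2))     ≡⟨ ∑<-extend _ (s≤s (s≤s z≤n)) vanish ⟩
    0ℚ +ℚ 1ℚ *ℚ ψ (r + suc k * 2) +ℚ - 1ℚ *ℚ ψ (r + k * 2)
      ≡⟨ cong₂ _+ℚ_ (trans (ℚ.+-identityˡ _) (ℚ.*-identityˡ (ψ (r + suc k * 2)))) (-1*x≈-x (ψ (r + k * 2))) ⟩
    ψ (r + suc k * 2) -ℚ ψ (r + k * 2)                   ∎
    where
    open ≡-Reasoning
    vanish : ∀ y → 2 ≤ y → y < 2 + k → wE y *ℚ ψ (r + (suc k ∸ y) * 2) ≡ 0ℚ
    vanish (suc zero)    (s≤s ()) _
    vanish (suc (suc y)) _        _ = ℚ.*-zeroˡ (ψ (r + (suc k ∸ suc (suc y)) * 2))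

H-E⁺ : (wH ↑ 2) ∗ wE⁺ ≗ wH
H-E⁺ = by-parity (λ k → wH-↑2-∗ wE⁺ (λ _ → refl) k 0 (s≤s z≤n))
                 (λ k → wH-↑2-∗ wE⁺ (λ _ → refl) k 1 (s≤s (s≤s z≤n)))

H-E : (wH ↑ 2) ∗ wE ≗ sgn
H-E = by-parity (λ k → trans (wH-↑2-∗ wE (λ _ → refl) k 0 (s≤s z≤n)) (sym (sgn-even k)))
                (λ k → trans (wH-↑2-∗ wE (λ _ → refl) k 1 (s≤s (s≤s z≤n))) (sym (cong -_ (sgn-even k))))

E-H⁺ : (wE ↑ 2) ∗ sgn ≗ wE
E-H⁺ zero          = refl
E-H⁺ (suc zero)    = refl
E-H⁺ (suc (suc n)) = trans (wE-↑2-∗ sgn n) (trans (cong (_-ℚ sgn n) (-‿involutive (sgn n))) (ℚ.+-inverseʳ (sgn n)))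

E-H : (wE ↑ 2) ∗ wH ≗ wE⁺
E-H zero          = refl
E-H (suc zero)    = refl
E-H (suc (suc n)) = wE-↑2-∗ wH n

-- The identities also hold for d = 0.
mainTheorem3 : (d m : ℕ) → 1 ≤ d → 1 ≤ m →
    (pleth m (H d) ≈S conv H E⁺ d m) ×
    (pleth m (H⁺ d) ≈S conv H E d m) ×
    (pleth m (E d) ≈S conv E H⁺ d m) ×
    (pleth m (E⁺ d) ≈S conv E H d m)
mainTheorem3 d m _ 1≤m =
  pleth-≈S-conv m H-graded E⁺-graded H-graded  H-E⁺ d ,
  pleth-≈S-conv m H-graded E-graded  H⁺-graded H-E  d ,
  pleth-≈S-conv m E-graded H⁺-graded E-graded  E-H⁺ d ,
  pleth-≈S-conv m E-graded H-graded  E⁺-graded E-H  d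
  where
  instance
    m≢0 : NonZero m
    m≢0 = >-nonZero 1≤m
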